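{- Let $A$ be an MV-algebra and let $I_1,\dots,I_n$ be principal MV-ideals of $A$ with $\bigcap_{l=1}^n I_l=\{0\}$. Let $a_1,\dots,a_n\in A$ satisfy $a_i\equiv a_j \pmod{I_i\oplus I_j}$ for all $i,j\in\{1,\dots,n\}$. Then there exists a unique $b\in A$ with $b\equiv a_l\pmod{I_l}$ for every $l=1,\dots,n$.
   Context: MV-algebra $(A,\oplus,\neg,0)$: $(A,\oplus,0)$ commutative monoid, $\neg\neg x=x$, $x\oplus\neg0=\neg0$, $\neg(\neg x\oplus y)\oplus y=\neg(\neg y\oplus x)\oplus x$; $x\ominus y:=\neg(\neg x\oplus y)$; lattice order with $x\vee y:=\neg(\neg x\oplus y)\oplus y$. An MV-ideal is a downset containing $0$ closed under $\oplus$; it is principal if it is the smallest MV-ideal containing some single element. For MV-ideals $I,J$, $I\oplus J:=\{c\in A:\exists a\in I,b\in J,\ c\le a\oplus b\}$ (the MV-ideal generated by $I\cup J$). For an MV-ideal $I$, $a\equiv b\pmod I$ means $a$ and $b$ are congruent for the MV-congruence associated with $I$, i.e. $(a\ominus b)\oplus(b\ominus a)\in I$. -}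

module Defs where

open import Level using (0ℓ)
open import Data.Nat using (ℕ)
open import Data.Fin using (Fin)
open import Data.Product using (Σ; _×_; ∃; ∃-syntax; _,_)
open import Relation.Unary using (Pred; _∈_; _⊆_)
open import Relation.Binary.PropositionalEquality using (_≡_)

record MVAlgebra : Set₁ where
  infixl 6 _⊕_
  infix  8 ¬_
  field
    Carrier : Set
    _⊕_     : Carrier → Carrier → Carrier
    ¬_      : Carrier → Carrier
    𝟘       : Carrier
    ⊕-assoc    : ∀ x y z → (x ⊕ y) ⊕ z ≡ x ⊕ (y ⊕ z)
    ⊕-comm     : ∀ x y → x ⊕ y ≡ y ⊕ x
    ⊕-identityʳ : ∀ x → x ⊕ 𝟘 ≡ x
    ¬-involutive : ∀ x → ¬ ¬ x ≡ x
    ⊕-absorb   : ∀ x → x ⊕ ¬ 𝟘 ≡ ¬ 𝟘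
    mv-axiom   : ∀ x y → ¬ (¬ x ⊕ y) ⊕ y ≡ ¬ (¬ y ⊕ x) ⊕ x

  infixl 6 _⊖_
  _⊖_ : Carrier → Carrier → Carrier
  x ⊖ y = ¬ (¬ x ⊕ y)

  _∨_ : Carrier → Carrier → Carrier
  x ∨ y = (x ⊖ y) ⊕ y

  infix 4 _≤_
  _≤_ : Carrier → Carrier → Set
  x ≤ y = x ∨ y ≡ y

  record IsIdeal (I : Pred Carrier 0ℓ) : Set where
    field
      zero-mem : 𝟘 ∈ I
      downward : ∀ {x y} → x ≤ y → y ∈ I → x ∈ I
      ⊕-closed : ∀ {x y} → x ∈ I → y ∈ I → (x ⊕ y) ∈ I

  IsPrincipal : Pred Carrier 0ℓ → Set₁
  IsPrincipal I = IsIdeal I × ∃[ a ] (a ∈ I × ((J : Pred Carrier 0ℓ) → IsIdeal J → a ∈ J → I ⊆ J))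

  _⊕ᴵ_ : Pred Carrier 0ℓ → Pred Carrier 0ℓ → Pred Carrier 0ℓ
  (I ⊕ᴵ J) c = ∃[ a ] ∃[ b ] (a ∈ I × b ∈ J × c ≤ a ⊕ b)

  _≡_[mod_] : Carrier → Carrier → Pred Carrier 0ℓ → Set
  a ≡ b [mod I ] = ((a ⊖ b) ⊕ (b ⊖ a)) ∈ I

-- MV-algebras are congruence-permutable: if x ⊖ y and y ⊖ x are bounded by U ⊕ W,
-- then c = (y ∧ (x ⊕ U)) ∨ (x ⊖ U) is within U of x and within W of y. Induction on n
-- then glues one ideal at a time: a solution b for I₁, …, Iₙ is congruent to a₀
-- modulo I₀ ⊕ (I₁ ∩ ⋯ ∩ Iₙ), and permutability produces an element congruent to a₀
-- modulo I₀ and to b modulo every other Iₗ. Uniqueness holds because two solutions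
-- are congruent modulo ⋂ Iₗ = {0}. Principality is only used to know that each Iₗ is
-- an ideal.
module Submission where

open import Defs
open import Level using (0ℓ)
open import Data.Nat using (ℕ; zero; suc)
open import Data.Fin using (Fin; zero; suc)
open import Data.Product using (Σ; _×_; ∃-syntax; _,_; proj₁; proj₂)
open import Data.Vec.Functional using (Vector; foldr; tail)
open import Relation.Unary using (Pred; _∈_)
open import Relation.Binary.PropositionalEquality
  using (_≡_; refl; sym; trans; cong; subst; subst₂; module ≡-Reasoning)

module MVAlgebraProperties (A : MVAlgebra) where
  open MVAlgebra A
  open ≡-Reasoning

  𝟙 : Carrier
  𝟙 = ¬ 𝟘

  ⊕-identityˡ : ∀ x → 𝟘 ⊕ x ≡ x
  ⊕-identityˡ x = trans (⊕-comm 𝟘 x) (⊕-identityʳ x)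

  ⊕-absorbˡ : ∀ x → 𝟙 ⊕ x ≡ 𝟙
  ⊕-absorbˡ x = trans (⊕-comm 𝟙 x) (⊕-absorb x)

  ¬𝟙≡𝟘 : ¬ 𝟙 ≡ 𝟘
  ¬𝟙≡𝟘 = ¬-involutive 𝟘

  ⊕-swap : ∀ x y z → x ⊕ (y ⊕ z) ≡ y ⊕ (x ⊕ z)
  ⊕-swap x y z = begin
    x ⊕ (y ⊕ z) ≡⟨ sym (⊕-assoc x y z) ⟩
    (x ⊕ y) ⊕ z ≡⟨ cong (_⊕ z) (⊕-comm x y) ⟩
    (y ⊕ x) ⊕ z ≡⟨ ⊕-assoc y x z ⟩
    y ⊕ (x ⊕ z) ∎

  ¬-inverseˡ : ∀ x → ¬ x ⊕ x ≡ 𝟙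
  ¬-inverseˡ x = begin
    ¬ x ⊕ x         ≡⟨ cong (λ t → ¬ t ⊕ x) (sym (⊕-identityˡ x)) ⟩
    ¬ (𝟘 ⊕ x) ⊕ x   ≡⟨ cong (λ t → ¬ (t ⊕ x) ⊕ x) (sym ¬𝟙≡𝟘) ⟩
    ¬ (¬ 𝟙 ⊕ x) ⊕ x ≡⟨ mv-axiom 𝟙 x ⟩
    ¬ (¬ x ⊕ 𝟙) ⊕ 𝟙 ≡⟨ ⊕-absorb _ ⟩
    𝟙               ∎

  -- The natural order, in the form that makes residuation a one-line calculation;
  -- ≤⇒≼ and ≼⇒≤ relate it to the order _≤_ of the structure.
  infix 4 _≼_
  _≼_ : Carrier → Carrier → Set
  x ≼ y = ¬ x ⊕ y ≡ 𝟙

  ≼-reflexive : ∀ {x y} → x ≡ y → x ≼ y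
  ≼-reflexive {x} refl = ¬-inverseˡ x

  ≼-respʳ : ∀ {x y y′} → y ≡ y′ → x ≼ y → x ≼ y′
  ≼-respʳ {x} = subst (x ≼_)

  x≼x⊕y : ∀ x y → x ≼ x ⊕ y
  x≼x⊕y x y = begin
    ¬ x ⊕ (x ⊕ y) ≡⟨ sym (⊕-assoc (¬ x) x y) ⟩
    (¬ x ⊕ x) ⊕ y ≡⟨ cong (_⊕ y) (¬-inverseˡ x) ⟩
    𝟙 ⊕ y         ≡⟨ ⊕-absorbˡ y ⟩
    𝟙             ∎

  y≼x⊕y : ∀ x y → y ≼ x ⊕ y
  y≼x⊕y x y = ≼-respʳ (⊕-comm y x) (x≼x⊕y y x)

  ≼⇒⊖≡𝟘 : ∀ {x y} → x ≼ y → x ⊖ y ≡ 𝟘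
  ≼⇒⊖≡𝟘 x≼y = trans (cong ¬_ x≼y) ¬𝟙≡𝟘

  ⊖≡𝟘⇒≼ : ∀ {x y} → x ⊖ y ≡ 𝟘 → x ≼ y
  ⊖≡𝟘⇒≼ {x} {y} x⊖y≡𝟘 = trans (sym (¬-involutive (¬ x ⊕ y))) (cong ¬_ x⊖y≡𝟘)

  ≼⇒≡⊕⊖ : ∀ {x y} → x ≼ y → y ≡ x ⊕ (y ⊖ x)
  ≼⇒≡⊕⊖ {x} {y} x≼y = begin
    y           ≡⟨ sym (⊕-identityˡ y) ⟩
    𝟘 ⊕ y       ≡⟨ cong (_⊕ y) (sym (≼⇒⊖≡𝟘 x≼y)) ⟩
    (x ⊖ y) ⊕ y ≡⟨ mv-axiom x y ⟩
    (y ⊖ x) ⊕ x ≡⟨ ⊕-comm _ x ⟩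
    x ⊕ (y ⊖ x) ∎

  ≼-trans : ∀ {x y z} → x ≼ y → y ≼ z → x ≼ z
  ≼-trans {x} {y} {z} x≼y y≼z = ≼-respʳ (sym z≡) (x≼x⊕y x _)
    where
    z≡ : z ≡ x ⊕ ((y ⊖ x) ⊕ (z ⊖ y))
    z≡ = begin
      z                           ≡⟨ ≼⇒≡⊕⊖ y≼z ⟩
      y ⊕ (z ⊖ y)                 ≡⟨ cong (_⊕ (z ⊖ y)) (≼⇒≡⊕⊖ x≼y) ⟩
      (x ⊕ (y ⊖ x)) ⊕ (z ⊖ y)     ≡⟨ ⊕-assoc x _ _ ⟩
      x ⊕ ((y ⊖ x) ⊕ (z ⊖ y))     ∎

  ≼-antisym : ∀ {x y} → x ≼ y → y ≼ x → x ≡ y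
  ≼-antisym {x} {y} x≼y y≼x = begin
    x           ≡⟨ sym (⊕-identityˡ x) ⟩
    𝟘 ⊕ x       ≡⟨ cong (_⊕ x) (sym (≼⇒⊖≡𝟘 y≼x)) ⟩
    (y ⊖ x) ⊕ x ≡⟨ sym (mv-axiom x y) ⟩
    (x ⊖ y) ⊕ y ≡⟨ cong (_⊕ y) (≼⇒⊖≡𝟘 x≼y) ⟩
    𝟘 ⊕ y       ≡⟨ ⊕-identityˡ y ⟩
    y           ∎

  ≼⇒≤ : ∀ {x y} → x ≼ y → x ≤ y
  ≼⇒≤ {x} {y} x≼y = trans (cong (_⊕ y) (≼⇒⊖≡𝟘 x≼y)) (⊕-identityˡ y)

  ≤⇒≼ : ∀ {x y} → x ≤ y → x ≼ y
  ≤⇒≼ {x} {y} x≤y = ≼-respʳ y≡ (x≼x⊕y x (y ⊖ x))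
    where
    y≡ : x ⊕ (y ⊖ x) ≡ y
    y≡ = trans (⊕-comm x _) (trans (sym (mv-axiom x y)) x≤y)

  ⊕-monoˡ-≼ : ∀ {x y} z → x ≼ y → x ⊕ z ≼ y ⊕ z
  ⊕-monoˡ-≼ {x} {y} z x≼y = ≼-respʳ (sym y⊕z≡) (x≼x⊕y (x ⊕ z) (y ⊖ x))
    where
    y⊕z≡ : y ⊕ z ≡ (x ⊕ z) ⊕ (y ⊖ x)
    y⊕z≡ = begin
      y ⊕ z             ≡⟨ cong (_⊕ z) (≼⇒≡⊕⊖ x≼y) ⟩
      (x ⊕ (y ⊖ x)) ⊕ z ≡⟨ ⊕-assoc x _ z ⟩
      x ⊕ ((y ⊖ x) ⊕ z) ≡⟨ cong (x ⊕_) (⊕-comm _ z) ⟩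
      x ⊕ (z ⊕ (y ⊖ x)) ≡⟨ sym (⊕-assoc x z _) ⟩
      (x ⊕ z) ⊕ (y ⊖ x) ∎

  ⊕-monoʳ-≼ : ∀ {x y} z → x ≼ y → z ⊕ x ≼ z ⊕ y
  ⊕-monoʳ-≼ {x} {y} z x≼y =
    subst₂ _≼_ (⊕-comm x z) (⊕-comm y z) (⊕-monoˡ-≼ z x≼y)

  ¬-antitone : ∀ {x y} → x ≼ y → ¬ y ≼ ¬ x
  ¬-antitone {x} {y} x≼y =
    trans (cong (_⊕ ¬ x) (¬-involutive y)) (trans (⊕-comm y (¬ x)) x≼y)

  ¬-reflects-≼ : ∀ {x y} → ¬ x ≼ ¬ y → y ≼ x
  ¬-reflects-≼ {x} {y} ¬x≼¬y =
    subst₂ _≼_ (¬-involutive y) (¬-involutive x) (¬-antitone ¬x≼¬y)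

  ⊖-residual⁺ : ∀ {x y z} → x ⊖ y ≼ z → x ≼ y ⊕ z
  ⊖-residual⁺ {x} {y} {z} x⊖y≼z = begin
    ¬ x ⊕ (y ⊕ z)     ≡⟨ sym (⊕-assoc _ y z) ⟩
    (¬ x ⊕ y) ⊕ z     ≡⟨ cong (_⊕ z) (sym (¬-involutive _)) ⟩
    ¬ (x ⊖ y) ⊕ z     ≡⟨ x⊖y≼z ⟩
    𝟙                 ∎

  ⊖-residual⁻ : ∀ {x y z} → x ≼ y ⊕ z → x ⊖ y ≼ z
  ⊖-residual⁻ {x} {y} {z} x≼y⊕z = begin
    ¬ (x ⊖ y) ⊕ z ≡⟨ cong (_⊕ z) (¬-involutive _) ⟩
    (¬ x ⊕ y) ⊕ z ≡⟨ ⊕-assoc _ y z ⟩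
    ¬ x ⊕ (y ⊕ z) ≡⟨ x≼y⊕z ⟩
    𝟙             ∎

  x⊖y≼x : ∀ x y → x ⊖ y ≼ x
  x⊖y≼x x y = ⊖-residual⁻ (y≼x⊕y y x)

  x≼x∨y : ∀ x y → x ≼ x ∨ y
  x≼x∨y x y = ≼-respʳ (trans (⊕-comm x _) (sym (mv-axiom x y))) (x≼x⊕y x (y ⊖ x))

  y≼x∨y : ∀ x y → y ≼ x ∨ y
  y≼x∨y x y = y≼x⊕y (x ⊖ y) y

  ⊖-triangle : ∀ x y z → x ⊖ z ≼ (x ⊖ y) ⊕ (y ⊖ z)
  ⊖-triangle x y z = ⊖-residual⁻ (≼-respʳ rearrange x≼)
    where
    x≼ : x ≼ (x ⊖ y) ⊕ ((y ⊖ z) ⊕ z)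
    x≼ = ≼-trans (x≼x∨y x y) (⊕-monoʳ-≼ (x ⊖ y) (x≼x∨y y z))
    rearrange : (x ⊖ y) ⊕ ((y ⊖ z) ⊕ z) ≡ z ⊕ ((x ⊖ y) ⊕ (y ⊖ z))
    rearrange = trans (cong ((x ⊖ y) ⊕_) (⊕-comm _ z)) (⊕-swap _ z _)

  ∨-least : ∀ {x y z} → x ≼ z → y ≼ z → x ∨ y ≼ z
  ∨-least {x} {y} {z} x≼z y≼z =
    ≼-respʳ (sym (trans (≼⇒≡⊕⊖ y≼z) (⊕-comm y _)))
      (⊕-monoˡ-≼ y (¬-antitone (⊕-monoˡ-≼ y (¬-antitone x≼z))))

  infixr 7 _∧_
  _∧_ : Carrier → Carrier → Carrier
  x ∧ y = ¬ ((¬ x) ∨ (¬ y))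

  x∧y≼x : ∀ x y → x ∧ y ≼ x
  x∧y≼x x y = ¬-reflects-≼ (≼-respʳ (sym (¬-involutive _)) (x≼x∨y (¬ x) (¬ y)))

  x∧y≼y : ∀ x y → x ∧ y ≼ y
  x∧y≼y x y = ¬-reflects-≼ (≼-respʳ (sym (¬-involutive _)) (y≼x∨y (¬ x) (¬ y)))

  ∧-greatest : ∀ {x y z} → z ≼ x → z ≼ y → z ≼ x ∧ y
  ∧-greatest z≼x z≼y = ¬-reflects-≼
    (subst (_≼ _) (sym (¬-involutive _)) (∨-least (¬-antitone z≼x) (¬-antitone z≼y)))

  ⊖-interpolate : ∀ x y U W → x ⊖ y ≼ U ⊕ W → y ⊖ x ≼ U ⊕ W →
    ∃[ c ] (c ⊖ x ≼ U) × (x ⊖ c ≼ U) × (c ⊖ y ≼ W) × (y ⊖ c ≼ W)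
  ⊖-interpolate x y U W x⊖y≼ y⊖x≼ =
    c , ⊖-residual⁻ c≼x⊕U , ⊖-residual⁻ x≼c⊕U , ⊖-residual⁻ c≼y⊕W , ⊖-residual⁻ y≼c⊕W
    where
    c : Carrier
    c = (y ∧ (x ⊕ U)) ∨ (x ⊖ U)
    c≼x⊕U : c ≼ x ⊕ U
    c≼x⊕U = ∨-least (x∧y≼y y (x ⊕ U)) (≼-trans (x⊖y≼x x U) (x≼x⊕y x U))
    x≼c⊕U : x ≼ c ⊕ U
    x≼c⊕U = ≼-respʳ (⊕-comm U c) (⊖-residual⁺ (y≼x∨y (y ∧ (x ⊕ U)) (x ⊖ U)))
    x⊖U≼y⊕W : x ⊖ U ≼ y ⊕ W
    x⊖U≼y⊕W = ⊖-residual⁻ (≼-respʳ (⊕-swap y U W) (⊖-residual⁺ x⊖y≼))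
    c≼y⊕W : c ≼ y ⊕ W
    c≼y⊕W = ∨-least (≼-trans (x∧y≼x y (x ⊕ U)) (x≼x⊕y y W)) x⊖U≼y⊕W
    y⊖W≼x⊕U : y ⊖ W ≼ x ⊕ U
    y⊖W≼x⊕U = ⊖-residual⁻ (≼-respʳ (trans (cong (x ⊕_) (⊕-comm U W)) (⊕-swap x W U))
                                    (⊖-residual⁺ y⊖x≼))
    y≼c⊕W : y ≼ c ⊕ W
    y≼c⊕W = ≼-respʳ (⊕-comm W c) (⊖-residual⁺
      (≼-trans (∧-greatest (x⊖y≼x y W) y⊖W≼x⊕U) (x≼x∨y _ (x ⊖ U))))

  ∑ : ∀ {n} → Vector Carrier n → Carrier
  ∑ = foldr _⊕_ 𝟘

  ≼-∑ : ∀ {n} (u : Vector Carrier n) l → u l ≼ ∑ u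
  ≼-∑ u zero    = x≼x⊕y (u zero) (∑ (tail u))
  ≼-∑ u (suc l) = ≼-trans (≼-∑ (tail u) l) (y≼x⊕y (u zero) (∑ (tail u)))

  module _ {I : Pred Carrier 0ℓ} (isIdeal : IsIdeal I) where
    open IsIdeal isIdeal

    ≼-downward : ∀ {x y} → x ≼ y → y ∈ I → x ∈ I
    ≼-downward x≼y = downward (≼⇒≤ x≼y)

    ∑-closed : ∀ {n} (u : Vector Carrier n) → (∀ l → u l ∈ I) → ∑ u ∈ I
    ∑-closed {zero}  u u∈I = zero-mem
    ∑-closed {suc n} u u∈I = ⊕-closed (u∈I zero) (∑-closed (tail u) (λ l → u∈I (suc l)))

    ⊖-beyond-∈ : ∀ {p u v q U} → p ≼ (u ⊕ v) ⊕ q → u ≼ U → v ∈ I → q ∈ I → p ⊖ U ∈ I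
    ⊖-beyond-∈ {p} {u} {v} {q} {U} p≼ u≼U v∈I q∈I = ≼-downward p⊖U≼ (⊕-closed v∈I q∈I)
      where
      p⊖U≼ : p ⊖ U ≼ v ⊕ q
      p⊖U≼ = ⊖-residual⁻
        (≼-trans p≼ (≼-respʳ (⊕-assoc U v q) (⊕-monoˡ-≼ q (⊕-monoˡ-≼ v u≼U))))

  infix 4 _~[_]_
  _~[_]_ : Carrier → Pred Carrier 0ℓ → Carrier → Set
  x ~[ I ] y = (x ⊖ y ∈ I) × (y ⊖ x ∈ I)

  module _ {I : Pred Carrier 0ℓ} (isIdeal : IsIdeal I) where
    open IsIdeal isIdeal

    ≡[mod]⇒~ : ∀ {x y} → x ≡ y [mod I ] → x ~[ I ] y
    ≡[mod]⇒~ x≡y = ≼-downward isIdeal (x≼x⊕y _ _) x≡y , ≼-downward isIdeal (y≼x⊕y _ _) x≡y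

    ~⇒≡[mod] : ∀ {x y} → x ~[ I ] y → x ≡ y [mod I ]
    ~⇒≡[mod] (x⊖y∈I , y⊖x∈I) = ⊕-closed x⊖y∈I y⊖x∈I

    ~-sym : ∀ {x y} → x ~[ I ] y → y ~[ I ] x
    ~-sym (x⊖y∈I , y⊖x∈I) = y⊖x∈I , x⊖y∈I

    ~-trans : ∀ {x y z} → x ~[ I ] y → y ~[ I ] z → x ~[ I ] z
    ~-trans {x} {y} {z} (x⊖y∈I , y⊖x∈I) (y⊖z∈I , z⊖y∈I) =
      ≼-downward isIdeal (⊖-triangle x y z) (⊕-closed x⊖y∈I y⊖z∈I) ,
      ≼-downward isIdeal (⊖-triangle z y x) (⊕-closed z⊖y∈I y⊖x∈I)

  record CongruentModSum (I J : Pred Carrier 0ℓ) (x y : Carrier) : Set where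
    field
      u   : Carrier
      v   : Carrier
      u∈I : u ∈ I
      v∈J : v ∈ J
      x⊖y≼u⊕v : x ⊖ y ≼ u ⊕ v
      y⊖x≼u⊕v : y ⊖ x ≼ u ⊕ v

  ≡[mod⊕ᴵ]⇒CongruentModSum : ∀ {I J x y} → x ≡ y [mod (I ⊕ᴵ J) ] → CongruentModSum I J x y
  ≡[mod⊕ᴵ]⇒CongruentModSum (u , v , u∈I , v∈J , d≤u⊕v) = record
    { u = u ; v = v ; u∈I = u∈I ; v∈J = v∈J
    ; x⊖y≼u⊕v = ≼-trans (x≼x⊕y _ _) (≤⇒≼ d≤u⊕v)
    ; y⊖x≼u⊕v = ≼-trans (y≼x⊕y _ _) (≤⇒≼ d≤u⊕v)
    }

  module _ {I : Pred Carrier 0ℓ} (I-ideal : IsIdeal I)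
           {n} {J : Fin n → Pred Carrier 0ℓ} (J-ideal : ∀ l → IsIdeal (J l)) where

    -- With U the sum of the I-parts of the witnesses, the parts of x ⊖ b and b ⊖ x
    -- beyond U lie in every J l, so their sum W bounds both distances by U ⊕ W.
    ~-glue : ∀ x b (a : Vector Carrier n) →
      (∀ l → CongruentModSum I (J l) x (a l)) → (∀ l → b ~[ J l ] a l) →
      ∃[ c ] (c ~[ I ] x) × (∀ l → c ~[ J l ] a l)
    ~-glue x b a x≈a b~a = c , c~x , c~a
      where
      open CongruentModSum
      U : Carrier
      U = ∑ (λ l → u (x≈a l))
      U∈I : U ∈ I
      U∈I = ∑-closed I-ideal _ (λ l → u∈I (x≈a l))
      W : Carrier
      W = ((x ⊖ b) ⊖ U) ⊕ ((b ⊖ x) ⊖ U)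
      W∈J : ∀ l → W ∈ J l
      W∈J l = IsIdeal.⊕-closed (J-ideal l)
        (⊖-beyond-∈ (J-ideal l) x⊖b≼ (≼-∑ _ l) (v∈J w) (proj₂ (b~a l)))
        (⊖-beyond-∈ (J-ideal l) b⊖x≼ (≼-∑ _ l) (v∈J w) (proj₁ (b~a l)))
        where
        w : CongruentModSum I (J l) x (a l)
        w = x≈a l
        x⊖b≼ : x ⊖ b ≼ (u w ⊕ v w) ⊕ (a l ⊖ b)
        x⊖b≼ = ≼-trans (⊖-triangle x (a l) b) (⊕-monoˡ-≼ _ (x⊖y≼u⊕v w))
        b⊖x≼ : b ⊖ x ≼ (u w ⊕ v w) ⊕ (b ⊖ a l)
        b⊖x≼ = ≼-trans (⊖-triangle b (a l) x)
                       (≼-respʳ (⊕-comm _ _) (⊕-monoʳ-≼ _ (y⊖x≼u⊕v w)))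
      x⊖b≼U⊕W : x ⊖ b ≼ U ⊕ W
      x⊖b≼U⊕W = ≼-trans (⊖-residual⁺ (≼-reflexive refl)) (⊕-monoʳ-≼ U (x≼x⊕y _ _))
      b⊖x≼U⊕W : b ⊖ x ≼ U ⊕ W
      b⊖x≼U⊕W = ≼-trans (⊖-residual⁺ (≼-reflexive refl)) (⊕-monoʳ-≼ U (y≼x⊕y _ _))
      interpolant : ∃[ c ] (c ⊖ x ≼ U) × (x ⊖ c ≼ U) × (c ⊖ b ≼ W) × (b ⊖ c ≼ W)
      interpolant = ⊖-interpolate x b U W x⊖b≼U⊕W b⊖x≼U⊕W
      c : Carrier
      c = proj₁ interpolant
      c~x : c ~[ I ] x
      c~x = let (_ , c⊖x≼U , x⊖c≼U , _) = interpolant in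
        ≼-downward I-ideal c⊖x≼U U∈I , ≼-downward I-ideal x⊖c≼U U∈I
      c~a : ∀ l → c ~[ J l ] a l
      c~a l = let (_ , _ , _ , c⊖b≼W , b⊖c≼W) = interpolant in
        ~-trans (J-ideal l)
          (≼-downward (J-ideal l) c⊖b≼W (W∈J l) , ≼-downward (J-ideal l) b⊖c≼W (W∈J l))
          (b~a l)

  chinese-remainder : ∀ {n} (I : Fin n → Pred Carrier 0ℓ) → (∀ l → IsIdeal (I l)) →
    (a : Vector Carrier n) → (∀ i j → CongruentModSum (I i) (I j) (a i) (a j)) →
    ∃[ b ] (∀ l → b ~[ I l ] a l)
  chinese-remainder {zero}  I I-ideal a a≈a = 𝟘 , λ ()
  chinese-remainder {suc n} I I-ideal a a≈a
    with chinese-remainder (tail I) (λ l → I-ideal (suc l)) (tail a)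
                           (λ i j → a≈a (suc i) (suc j))
  ... | b , b~a with ~-glue (I-ideal zero) (λ l → I-ideal (suc l)) (a zero) b (tail a)
                            (λ l → a≈a zero (suc l)) b~a
  ... | c , c~a₀ , c~a = c , λ { zero → c~a₀ ; (suc l) → c~a l }

  ~-unique : ∀ {n} {I : Fin n → Pred Carrier 0ℓ} → (∀ x → (∀ l → x ∈ I l) → x ≡ 𝟘) →
    ∀ {x y} → (∀ l → x ~[ I l ] y) → x ≡ y
  ~-unique ⋂I≡𝟘 x~y = ≼-antisym (⊖≡𝟘⇒≼ (⋂I≡𝟘 _ (λ l → proj₁ (x~y l))))
                                (⊖≡𝟘⇒≼ (⋂I≡𝟘 _ (λ l → proj₂ (x~y l))))

corollary9p3 : (A : MVAlgebra) → let open MVAlgebra A in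
    (n : ℕ) (I : Fin n → Pred Carrier _) →
    (∀ l → IsPrincipal (I l)) →
    (∀ x → (∀ l → x ∈ I l) → x ≡ 𝟘) →
    (a : Fin n → Carrier) →
    (∀ i j → a i ≡ a j [mod (I i ⊕ᴵ I j) ]) →
    Σ Carrier (λ b → (∀ l → b ≡ a l [mod I l ]) ×
      (∀ b′ → (∀ l → b′ ≡ a l [mod I l ]) → b′ ≡ b))
corollary9p3 A n I I-principal ⋂I≡𝟘 a a≡a = b , b≡a , unique
  where
  open MVAlgebra A
  open MVAlgebraProperties A
  I-ideal : ∀ l → IsIdeal (I l)
  I-ideal l = proj₁ (I-principal l)
  solution : ∃[ b ] (∀ l → b ~[ I l ] a l)
  solution = chinese-remainder I I-ideal a (λ i j → ≡[mod⊕ᴵ]⇒CongruentModSum (a≡a i j))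
  b : Carrier
  b = proj₁ solution
  b≡a : ∀ l → b ≡ a l [mod I l ]
  b≡a l = ~⇒≡[mod] (I-ideal l) (proj₂ solution l)
  unique : ∀ b′ → (∀ l → b′ ≡ a l [mod I l ]) → b′ ≡ b
  unique b′ b′≡a = ~-unique ⋂I≡𝟘 (λ l →
    ~-trans (I-ideal l) (≡[mod]⇒~ (I-ideal l) (b′≡a l)) (~-sym (I-ideal l) (proj₂ solution l)))
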